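{- Let $\mathscr{C}$ be a set system on a finite set $V$ satisfying (L1): for all $A,B,C\in\mathscr{C}$, if $A\between B$ and $B\between C$, then $A\subseteq C$, or $C\subseteq A$, or $A\cap C\subseteq B\subseteq A\cup C$. Then $\mathscr{C}$ satisfies (N3O): for all $A,B,C\in\mathscr{C}$, if $A\between B$ and $B\between C$, then $A$ does not overlap $C$.
   Context: Sets $A,B$ overlap, written $A\between B$, if $A\cap B$, $A\setminus B$ and $B\setminus A$ are all non-empty. -}

module Defs where

open import Data.Nat using (ℕ)
open import Data.Product using (_×_)
open import Data.Sum using (_⊎_)
open import Relation.Nullary using (¬_)
open import Data.Fin.Subset using (Subset; _∩_; _∪_; _─_; _⊆_; Nonempty)

_≬_ : ∀ {n} → Subset n → Subset n → Set
A ≬ B = Nonempty (A ∩ B) × Nonempty (A ─ B) × Nonempty (B ─ A)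

SetSystem : ℕ → Set₁
SetSystem n = Subset n → Set

L1 : ∀ {n} → SetSystem n → Set
L1 𝒞 = ∀ A B C → 𝒞 A → 𝒞 B → 𝒞 C → A ≬ B → B ≬ C →
       (A ⊆ C) ⊎ (C ⊆ A) ⊎ ((A ∩ C ⊆ B) × (B ⊆ A ∪ C))

N3O : ∀ {n} → SetSystem n → Set
N3O 𝒞 = ∀ A B C → 𝒞 A → 𝒞 B → 𝒞 C → A ≬ B → B ≬ C → ¬ (A ≬ C)

{-# OPTIONS --safe #-}
-- Since A and C overlap, neither contains
-- the other, so (L1) for the chain A, B, C gives A ∩ C ⊆ B; since B and C overlap,
-- (L1) for the chain B, A, C gives A ⊆ B ∪ C. Together these force A ⊆ B,
-- contradicting A ≬ B.
module Submission where

open import Data.Nat using (ℕ)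
open import Data.Product using (_×_; _,_; proj₁; proj₂)
open import Data.Sum using (inj₁; inj₂; [_,_])
open import Function using (id)
open import Data.Empty using (⊥-elim)
open import Relation.Nullary using (¬_)
open import Data.Fin.Subset using (Subset; _∩_; _∪_; _─_; _⊆_; Nonempty; _∈_; _∉_; inside; outside)
open import Data.Fin.Subset.Properties using (x∈p∩q⁺; x∈p∩q⁻; x∈p∪q⁻; p─q⊆p)
open import Data.Vec.Base using (_∷_; there)
open import Defs

private
  variable
    n : ℕ
    A B C : Subset n

x∈p─q⇒x∉q : ∀ {x} (p q : Subset n) → x ∈ p ─ q → x ∉ q
x∈p─q⇒x∉q (_ ∷ p) (outside ∷ q) (there x∈p─q) (there x∈q) = x∈p─q⇒x∉q p q x∈p─q x∈q
x∈p─q⇒x∉q (_ ∷ p) (inside  ∷ q) (there x∈p─q) (there x∈q) = x∈p─q⇒x∉q p q x∈p─q x∈q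

Nonempty-─⇒⊈ : Nonempty (A ─ B) → ¬ (A ⊆ B)
Nonempty-─⇒⊈ {A = A} {B} (x , x∈A─B) A⊆B = x∈p─q⇒x∉q A B x∈A─B (A⊆B (p─q⊆p A B x∈A─B))

≬-sym : A ≬ B → B ≬ A
≬-sym {A = A} {B} ((x , x∈A∩B) , A─B , B─A) =
  (x , x∈p∩q⁺ (proj₂ (x∈p∩q⁻ A B x∈A∩B) , proj₁ (x∈p∩q⁻ A B x∈A∩B))) , B─A , A─B

≬⇒⊈ : A ≬ B → ¬ (A ⊆ B)
≬⇒⊈ (_ , A─B , _) = Nonempty-─⇒⊈ A─B

≬⇒⊉ : A ≬ B → ¬ (B ⊆ A)
≬⇒⊉ (_ , _ , B─A) = Nonempty-─⇒⊈ B─A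

∩⊆∧⊆∪⇒⊆ : A ∩ C ⊆ B → A ⊆ B ∪ C → A ⊆ B
∩⊆∧⊆∪⇒⊆ {A = A} {C} {B} A∩C⊆B A⊆B∪C x∈A =
  [ id , (λ x∈C → A∩C⊆B (x∈p∩q⁺ (x∈A , x∈C))) ] (x∈p∪q⁻ B C (A⊆B∪C x∈A))

L1-overlapping-ends : ∀ {𝒞 : SetSystem n} → L1 𝒞 → 𝒞 A → 𝒞 B → 𝒞 C →
                      A ≬ B → B ≬ C → A ≬ C → (A ∩ C ⊆ B) × (B ⊆ A ∪ C)
L1-overlapping-ends {A = A} {B} {C} l1 𝒞A 𝒞B 𝒞C A≬B B≬C A≬C
  with l1 A B C 𝒞A 𝒞B 𝒞C A≬B B≬C
... | inj₁ A⊆C        = ⊥-elim (≬⇒⊈ A≬C A⊆C)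
... | inj₂ (inj₁ C⊆A) = ⊥-elim (≬⇒⊉ A≬C C⊆A)
... | inj₂ (inj₂ betweenness) = betweenness

mainTheorem10 : ∀ (n : ℕ) (𝒞 : SetSystem n) → L1 𝒞 → N3O 𝒞
mainTheorem10 n 𝒞 l1 A B C 𝒞A 𝒞B 𝒞C A≬B B≬C A≬C = ≬⇒⊈ A≬B A⊆B
  where
  A∩C⊆B : A ∩ C ⊆ B
  A∩C⊆B = proj₁ (L1-overlapping-ends l1 𝒞A 𝒞B 𝒞C A≬B B≬C A≬C)

  A⊆B∪C : A ⊆ B ∪ C
  A⊆B∪C = proj₂ (L1-overlapping-ends l1 𝒞B 𝒞A 𝒞C (≬-sym A≬B) A≬C B≬C)

  A⊆B : A ⊆ B
  A⊆B = ∩⊆∧⊆∪⇒⊆ A∩C⊆B A⊆B∪C
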